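{- Let $\mathcal{P}$ be a commutative ring with identity. Let $P\in M_{p_1\times p_2}(\mathcal{P})$ and $Q\in M_{q_1\times q_2}(\mathcal{P})$ with $p_1+q_1=p_2+q_2$, and let ${\bf a}\in \mathcal{P}^{q_1}$, ${\bf b}\in \mathcal{P}^{q_2}$. Then \[ {\rm det}(J(P,{\bf a}; Q,{\bf b}))= \begin{cases} {\rm det}(P)\cdot {\rm det}(Q)- {\rm det} \left[\begin{array}{cc} P&{\bf 1}^T\\ {\bf 1}&0 \end{array}\right] \cdot {\rm det} \left[\begin{array}{cc} 0&{\bf b}\\ {\bf a}^T&Q \end{array}\right] & \text{ if } p_1=p_2,\\[2mm] {\rm det} \left[\begin{array}{cc} P & {\bf 1}^T \end{array}\right] \cdot {\rm det} \left[\begin{array}{c} {\bf b}\\ Q \end{array}\right] & \text{ if } p_1=p_2+1,\\[2mm] {\rm det} \left[\begin{array}{c} P\\ {\bf 1} \end{array}\right] \cdot {\rm det} \left[\begin{array}{cc} {\bf a}^T &Q \end{array}\right] & \text{ if } p_2=p_1+1,\\[2mm] 0 & \text{ otherwise,} \end{cases} \] where in each case ${\bf 1}^T$ denotes an all-ones column and ${\bf 1}$ an all-ones row of the appropriate length (so that all displayed matrices are square).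
   Context: Vectors are row vectors. For ${\bf a}\in \mathcal{P}^{q_1}$, ${\bf b}\in \mathcal{P}^{q_2}$, $P\in M_{p_1\times p_2}(\mathcal{P})$, $Q\in M_{q_1\times q_2}(\mathcal{P})$ with $p_1+q_1=p_2+q_2$, the join is the square matrix \[ J(P,{\bf a};Q,{\bf b})=\left[\begin{array}{cc} P & {\bf 1}_{p_1}^T{\bf b}\\ {\bf a}^T {\bf 1}_{p_2} & Q\end{array}\right]\in M_{p_1+q_1}(\mathcal{P}), \] where ${\bf 1}_r$ is the all-ones row vector of length $r$; i.e. the upper right block has every row equal to ${\bf b}$ and the lower left block has every column equal to ${\bf a}^T$. Conventions for empty matrices: the determinant of a $0\times 0$ matrix is $1$; if $P\in M_{1\times 0}$ then $[P\ \ {\bf 1}^T]=[1]$, and if $P\in M_{0\times 1}$ then $\left[\begin{smallmatrix}P\\ {\bf 1}\end{smallmatrix}\right]=[1]$. -}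

module Defs where

open import Level using (Level)
open import Algebra.Bundles using (CommutativeRing)
open import Data.Nat using (ℕ; zero; suc) renaming (_+_ to _ℕ+_)
open import Data.Nat.Properties using (+-cancelˡ-≡; +-suc; +-comm; +-assoc)
open import Data.Fin using (Fin; zero; suc; splitAt; punchIn; cast)
open import Data.Sum using (inj₁; inj₂)
open import Relation.Binary.PropositionalEquality using (_≡_; refl; sym; trans; cong)

Mat : ∀ {c} → Set c → ℕ → ℕ → Set c
Mat A m n = Fin m → Fin n → A

Vect : ∀ {c} → Set c → ℕ → Set c
Vect A n = Fin n → A

hcat : ∀ {c} {A : Set c} {m a b} → Mat A m a → Mat A m b → Mat A m (a ℕ+ b)
hcat {a = a} M N i j with splitAt a j
... | inj₁ j' = M i j'
... | inj₂ j' = N i j'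

vcat : ∀ {c} {A : Set c} {a b n} → Mat A a n → Mat A b n → Mat A (a ℕ+ b) n
vcat {a = a} M N i j with splitAt a i
... | inj₁ i' = M i' j
... | inj₂ i' = N i' j

block : ∀ {c} {X : Set c} {a b d e} →
        Mat X a d → Mat X a e → Mat X b d → Mat X b e → Mat X (a ℕ+ b) (d ℕ+ e)
block A B C D = vcat (hcat A B) (hcat C D)

module _ {c ℓ} (R : CommutativeRing c ℓ) where
  open CommutativeRing R using (Carrier; _+_; _*_; -_; 0#; 1#)

  sumF : ∀ {n} → (Fin n → Carrier) → Carrier
  sumF {zero}  f = 0#
  sumF {suc n} f = f zero + sumF (λ j → f (suc j))

  sgn : ∀ {n} → Fin n → Carrier
  sgn zero    = 1#
  sgn (suc j) = - sgn j

  minor : ∀ {n} → Mat Carrier (suc n) (suc n) → Fin (suc n) → Mat Carrier n n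
  minor M j i k = M (suc i) (punchIn j k)

  det : ∀ {n} → Mat Carrier n n → Carrier
  det {zero}  M = 1#
  det {suc n} M = sumF (λ j → sgn j * (M zero j * det (minor M j)))

  detSq : ∀ {m n} → m ≡ n → Mat Carrier m n → Carrier
  detSq e M = det (λ i j → M i (cast e j))

  join : ∀ {p₁ p₂ q₁ q₂} → Mat Carrier p₁ p₂ → Vect Carrier q₁ →
         Mat Carrier q₁ q₂ → Vect Carrier q₂ → Mat Carrier (p₁ ℕ+ q₁) (p₂ ℕ+ q₂)
  join P a Q b = block P (λ _ j → b j) (λ i _ → a i) Q

  ones : ∀ {m n} → Mat Carrier m n
  ones _ _ = 1#

  zeros : ∀ {m n} → Mat Carrier m n
  zeros _ _ = 0#

  rowOf : ∀ {n} → Vect Carrier n → Mat Carrier 1 n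
  rowOf v _ j = v j

  colOf : ∀ {n} → Vect Carrier n → Mat Carrier n 1
  colOf v i _ = v i

dim₁ : ∀ {p₁ p₂ q₁ q₂} → p₁ ℕ+ q₁ ≡ p₂ ℕ+ q₂ → p₁ ≡ p₂ → q₁ ≡ q₂
dim₁ {p₁} e refl = +-cancelˡ-≡ p₁ _ _ e

dim₂ : ∀ {p₁ p₂ q₁ q₂} → p₁ ℕ+ q₁ ≡ p₂ ℕ+ q₂ → p₁ ≡ p₂ ℕ+ 1 → 1 ℕ+ q₁ ≡ q₂
dim₂ {p₂ = p₂} {q₁} e refl =
  +-cancelˡ-≡ p₂ _ _ (trans (sym (+-assoc p₂ 1 q₁)) e)

dim₃ : ∀ {p₁ p₂ q₁ q₂} → p₁ ℕ+ q₁ ≡ p₂ ℕ+ q₂ → p₂ ≡ p₁ ℕ+ 1 → q₁ ≡ 1 ℕ+ q₂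
dim₃ e h = sym (dim₂ (sym e) h)

module Submission where

-- Here det is defined by expansion along the first row, and the proof runs
-- by induction on p₁ using nothing but that expansion.  The key observation is that joins are closed under the
-- first-row minors: when p₁ > 0 the first row of J is (P₀ | b), and
--   det J(P,a;Q,b) = Σⱼ ±P₀ⱼ det J(Pⱼ,a;Q,b) + (−1)^p₂ Σₖ ±bₖ det J(P′,a;Qₖ,bₖ)
-- where Pⱼ deletes row 0 and column j of P, P′ deletes row 0 of P, and Qₖ, bₖ
-- delete column k.  Every auxiliary matrix of the theorem is again a join with
-- constant border blocks ([P 1ᵀ;1 0] = J(P,1;0,1), [0 b;aᵀ Q] = J(0,a;Q,b),
-- [P 1ᵀ], [b;Q], [P;1], [aᵀ Q] are joins with an empty block), so each of the
-- four cases follows by applying the induction hypothesis to the minors and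
-- recognising the resulting sums as first-row expansions of the auxiliary
-- determinants.  Two such sums vanish because they expand joins with two equal
-- first rows; this uses the alternation property of det, proved first.  For
-- p₁ = 0 and p₂ ≥ 2 the join [aᵀ1 | Q] has two equal columns; its determinant
-- vanishes by a separate induction on q₁.

open import Defs
open import Algebra.Bundles using (CommutativeRing)
open import Data.Nat using (ℕ; zero; suc; pred; _≟_) renaming (_+_ to _ℕ+_)
import Data.Nat.Properties as ℕ
open import Data.Fin using (Fin; zero; suc; splitAt; punchIn; cast; _↑ˡ_; _↑ʳ_)
open import Data.Fin.Properties using (cast-is-id; cast-trans; splitAt-↑ˡ; splitAt-↑ʳ)
open import Data.Sum using (_⊎_; inj₁; inj₂; [_,_]′; map₁; map₂)
open import Data.Sum.Properties using (map-map; map₁₂-map₂₁)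
open import Data.Product using (_×_; _,_)
open import Data.Unit using (⊤; tt)
open import Data.Empty using (⊥-elim)
open import Data.Maybe using (nothing)
open import Function using (_∘_)
open import Level using (Lift; lift; _⊔_)
open import Relation.Nullary using (yes; no)
open import Relation.Binary.PropositionalEquality
  using (_≡_; _≢_; refl; cong; cong₂; sym; trans; module ≡-Reasoning)
open import Tactic.RingSolver.Core.AlmostCommutativeRing using (fromCommutativeRing)

-- Columns of the minor deleting column c, for a matrix whose n′ columns are
-- identified with Fin (suc n) by a cast (as in detSq).
minorCol : ∀ {n n′} → .(suc n ≡ n′) → Fin n′ → Fin n → Fin n′
minorCol e c k = cast e (punchIn (cast (sym e) c) k)

splitAt-punchIn-↑ˡ : ∀ p q (j : Fin (suc p)) (x : Fin (p ℕ+ q)) →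
                     splitAt (suc p) (punchIn (j ↑ˡ q) x) ≡ map₁ (punchIn j) (splitAt p x)
splitAt-punchIn-↑ˡ p       q zero    x       = refl
splitAt-punchIn-↑ˡ (suc p) q (suc j) zero    = refl
splitAt-punchIn-↑ˡ (suc p) q (suc j) (suc x) = begin
  map₁ suc (splitAt (suc p) (punchIn (j ↑ˡ q) x)) ≡⟨ cong (map₁ suc) (splitAt-punchIn-↑ˡ p q j x) ⟩
  map₁ suc (map₁ (punchIn j) (splitAt p x))        ≡⟨ map-map (splitAt p x) ⟩
  map₁ (suc ∘ punchIn j) (splitAt p x)             ≡⟨ map-map (splitAt p x) ⟨
  map₁ (punchIn (suc j)) (map₁ suc (splitAt p x)) ∎
  where open ≡-Reasoning

minorCol-↑ˡ : ∀ p {q n} (j : Fin (suc p)) .(e : suc n ≡ suc p ℕ+ q) (e₁ : n ≡ p ℕ+ q) (x : Fin n) →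
              splitAt (suc p) (minorCol e (j ↑ˡ q) x) ≡ map₁ (punchIn j) (splitAt p (cast e₁ x))
minorCol-↑ˡ p {q} j e refl x
  rewrite cast-is-id e (punchIn (cast (sym e) (j ↑ˡ q)) x)
        | cast-is-id (sym e) (j ↑ˡ q)
        | cast-is-id refl x
  = splitAt-punchIn-↑ˡ p q j x

minorCol-↑ʳ : ∀ p {q n} (k : Fin (suc q)) .(e : suc n ≡ p ℕ+ suc q) (e₂ : n ≡ p ℕ+ q) (x : Fin n) →
              splitAt p (minorCol e (p ↑ʳ k) x) ≡ map₂ (punchIn k) (splitAt p (cast e₂ x))
minorCol-↑ʳ zero    k e refl x =
  cong inj₂ (trans (cast-is-id e _) (cong₂ punchIn (cast-is-id (sym e) k) (sym (cast-is-id refl x))))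
minorCol-↑ʳ (suc p) k e refl zero    = refl
minorCol-↑ʳ (suc p) k e refl (suc x) =
  trans (cong (map₁ suc) (minorCol-↑ʳ p k (cong pred e) refl x)) (map₁₂-map₂₁ (splitAt p (cast refl x)))

splitAt-+0 : ∀ m (i : Fin (m ℕ+ 0)) → splitAt m i ≡ inj₁ (cast (ℕ.+-identityʳ m) i)
splitAt-+0 (suc m) zero    = refl
splitAt-+0 (suc m) (suc i) = cong (map₁ suc) (splitAt-+0 m i)

module JoinDeterminant {c ℓ} (R : CommutativeRing c ℓ) where
  open CommutativeRing R hiding (zero)
    renaming (refl to ≈-refl; sym to ≈-sym; trans to ≈-trans; reflexive to ≈-reflexive)
  open import Algebra.Properties.Ring ring
    using (-0#≈0#; -‿involutive; -‿+-comm; -‿distribˡ-*; -‿distribʳ-*; -1*x≈-x)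
  open import Algebra.Properties.Semiring.Sum semiring
    using (sum; sum-cong-≋; ∑-distrib-+; *-distribˡ-sum)
  open import Relation.Binary.Reasoning.Setoid setoid
  open import Tactic.RingSolver.NonReflective (fromCommutativeRing R (λ _ → nothing))
    using (solve; _⊜_; _⊕_; _⊗_)

  private
    C = Carrier

  -- Finite sums.  Defs' sumF is the library's sum, which supplies the
  -- distributivity laws.
  sumF≡sum : ∀ {n} (f : Fin n → C) → sumF R f ≡ sum f
  sumF≡sum {zero}  f = refl
  sumF≡sum {suc n} f = cong (f zero +_) (sumF≡sum (f ∘ suc))

  sumF-cong : ∀ {n} {f g : Fin n → C} → (∀ i → f i ≈ g i) → sumF R f ≈ sumF R g
  sumF-cong {f = f} {g} h = begin
    sumF R f ≡⟨ sumF≡sum f ⟩ sum f ≈⟨ sum-cong-≋ h ⟩ sum g ≡⟨ sumF≡sum g ⟨ sumF R g ∎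

  sumF-+ : ∀ {n} (f g : Fin n → C) → sumF R (λ i → f i + g i) ≈ sumF R f + sumF R g
  sumF-+ f g = begin
    sumF R (λ i → f i + g i) ≡⟨ sumF≡sum (λ i → f i + g i) ⟩
    sum (λ i → f i + g i)    ≈⟨ ∑-distrib-+ f g ⟩
    sum f + sum g            ≡⟨ cong₂ _+_ (sumF≡sum f) (sumF≡sum g) ⟨
    sumF R f + sumF R g      ∎

  sumF-*ˡ : ∀ {n} (x : C) (f : Fin n → C) → sumF R (λ i → x * f i) ≈ x * sumF R f
  sumF-*ˡ x f = begin
    sumF R (λ i → x * f i) ≡⟨ sumF≡sum (λ i → x * f i) ⟩
    sum (λ i → x * f i)    ≈⟨ *-distribˡ-sum x f ⟨
    x * sum f              ≡⟨ cong (x *_) (sumF≡sum f) ⟨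
    x * sumF R f           ∎

  sumF-neg : ∀ {n} (f : Fin n → C) → sumF R (λ i → - f i) ≈ - sumF R f
  sumF-neg {zero}  f = ≈-sym -0#≈0#
  sumF-neg {suc n} f = ≈-trans (+-congˡ (sumF-neg (f ∘ suc))) (-‿+-comm _ _)

  sumF-split : ∀ p q (f : Fin (p ℕ+ q) → C) →
               sumF R f ≈ sumF R (λ j → f (j ↑ˡ q)) + sumF R (λ k → f (p ↑ʳ k))
  sumF-split zero    q f = ≈-sym (+-identityˡ _)
  sumF-split (suc p) q f =
    ≈-trans (+-congˡ (sumF-split p q (f ∘ suc))) (≈-sym (+-assoc _ _ _))

  signℕ : ℕ → C
  signℕ zero    = 1#
  signℕ (suc p) = - signℕ p

  signℕ-square : ∀ p → signℕ p * signℕ p ≈ 1#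
  signℕ-square zero    = *-identityˡ 1#
  signℕ-square (suc p) = ≈-trans (sq (signℕ p)) (signℕ-square p)
    where
    sq : ∀ x → - x * - x ≈ x * x
    sq x = ≈-trans (≈-sym (-‿distribˡ-* x (- x)))
             (≈-trans (-‿cong (≈-sym (-‿distribʳ-* x x))) (-‿involutive _))

  sgn-↑ˡ : ∀ {p} q (j : Fin p) → sgn R (j ↑ˡ q) ≡ sgn R j
  sgn-↑ˡ q zero    = refl
  sgn-↑ˡ q (suc j) = cong -_ (sgn-↑ˡ q j)

  sgn-↑ʳ : ∀ p {q} (k : Fin q) → sgn R (p ↑ʳ k) ≈ signℕ p * sgn R k
  sgn-↑ʳ zero    k = ≈-sym (*-identityˡ _)
  sgn-↑ʳ (suc p) k = ≈-trans (-‿cong (sgn-↑ʳ p k)) (-‿distribˡ-* _ _)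

  -- The signed sum Σⱼ (−1)ʲ xⱼ fⱼ of a first-row expansion.  By definition
  -- det M = laplace (M zero) (λ j → det (minor M j)) for nonempty M.
  signedTerm : ∀ {n} → (Fin n → C) → (Fin n → C) → Fin n → C
  signedTerm x f j = sgn R j * (x j * f j)

  laplace : ∀ {n} → (Fin n → C) → (Fin n → C) → C
  laplace x f = sumF R (signedTerm x f)

  laplace-cong : ∀ {n} {x y f g : Fin n → C} →
                 (∀ j → x j ≈ y j) → (∀ j → f j ≈ g j) → laplace x f ≈ laplace y g
  laplace-cong hx hf = sumF-cong (λ j → *-congˡ (*-cong (hx j) (hf j)))

  laplace-congʳ : ∀ {n} (x : Fin n → C) {f g : Fin n → C} →
                  (∀ j → f j ≈ g j) → laplace x f ≈ laplace x g
  laplace-congʳ x hf = laplace-cong {x = x} (λ _ → ≈-refl) hf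

  laplace-+ : ∀ {n} (x f g : Fin n → C) → laplace x (λ j → f j + g j) ≈ laplace x f + laplace x g
  laplace-+ x f g =
    ≈-trans (sumF-cong (λ j → spread (sgn R j) (x j) (f j) (g j))) (sumF-+ (signedTerm x f) (signedTerm x g))
    where
    spread : ∀ s y u v → s * (y * (u + v)) ≈ s * (y * u) + s * (y * v)
    spread = solve 4 (λ s y u v → (s ⊗ (y ⊗ (u ⊕ v))) ⊜ (s ⊗ (y ⊗ u) ⊕ s ⊗ (y ⊗ v))) ≈-refl

  laplace-neg : ∀ {n} (x f : Fin n → C) → laplace x (λ j → - f j) ≈ - laplace x f
  laplace-neg x f = ≈-trans (sumF-cong (λ j → pull (sgn R j) (x j) (f j))) (sumF-neg (signedTerm x f))
    where
    pull : ∀ s y u → s * (y * - u) ≈ - (s * (y * u))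
    pull s y u = ≈-trans (*-congˡ (≈-sym (-‿distribʳ-* y u))) (≈-sym (-‿distribʳ-* s _))

  laplace-*ˡ : ∀ {n} (x f : Fin n → C) (z : C) → laplace x (λ j → z * f j) ≈ z * laplace x f
  laplace-*ˡ x f z = ≈-trans (sumF-cong (λ j → pull (sgn R j) (x j) z (f j))) (sumF-*ˡ z (signedTerm x f))
    where
    pull : ∀ s y z u → s * (y * (z * u)) ≈ z * (s * (y * u))
    pull = solve 4 (λ s y z u → (s ⊗ (y ⊗ (z ⊗ u))) ⊜ (z ⊗ (s ⊗ (y ⊗ u)))) ≈-refl

  laplace-*ʳ : ∀ {n} (x f : Fin n → C) (z : C) → laplace x (λ j → f j * z) ≈ laplace x f * z
  laplace-*ʳ x f z = begin
    laplace x (λ j → f j * z) ≈⟨ laplace-congʳ x (λ j → *-comm (f j) z) ⟩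
    laplace x (λ j → z * f j) ≈⟨ laplace-*ˡ x f z ⟩
    z * laplace x f           ≈⟨ *-comm z _ ⟩
    laplace x f * z           ∎

  laplace-vanish : ∀ {n} (x f : Fin n → C) → (∀ j → x j * f j ≈ 0#) → laplace x f ≈ 0#
  laplace-vanish x f h = vanish (λ j → ≈-trans (*-congˡ (h j)) (zeroʳ _))
    where
    vanish : ∀ {n} {g : Fin n → C} → (∀ j → g j ≈ 0#) → sumF R g ≈ 0#
    vanish {zero}  hg = ≈-refl
    vanish {suc n} hg = ≈-trans (+-cong (hg zero) (vanish (hg ∘ suc))) (+-identityˡ 0#)

  laplace-single : (x f : Fin 1 → C) → laplace x f ≈ x zero * f zero
  laplace-single x f = ≈-trans (+-identityʳ _) (*-identityˡ _)

  laplace-suc : ∀ {n} (x f : Fin (suc n) → C) →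
                laplace x f ≈ x zero * f zero + - laplace (x ∘ suc) (f ∘ suc)
  laplace-suc x f = +-cong (*-identityˡ _)
    (≈-trans (sumF-cong (λ j → ≈-sym (-‿distribˡ-* (sgn R j) (x (suc j) * f (suc j)))))
             (sumF-neg (signedTerm (x ∘ suc) (f ∘ suc))))

  laplace-split : ∀ p q (x f : Fin (p ℕ+ q) → C) →
    laplace x f ≈ laplace (λ j → x (j ↑ˡ q)) (λ j → f (j ↑ˡ q))
                  + signℕ p * laplace (λ k → x (p ↑ʳ k)) (λ k → f (p ↑ʳ k))
  laplace-split p q x f = ≈-trans (sumF-split p q _) (+-cong
    (sumF-cong (λ j → *-congʳ {x (j ↑ˡ q) * f (j ↑ˡ q)} (≈-reflexive (sgn-↑ˡ q j))))
    (≈-trans (sumF-cong (λ k → ≈-trans (*-congʳ {x (p ↑ʳ k) * f (p ↑ʳ k)} (sgn-↑ʳ p k)) (*-assoc _ _ _)))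
             (sumF-*ˡ (signℕ p) (signedTerm (x ∘ (p ↑ʳ_)) (f ∘ (p ↑ʳ_))))))

  det-cong : ∀ {n} {M N : Mat C n n} → (∀ i j → M i j ≈ N i j) → det R M ≈ det R N
  det-cong {zero}  h = ≈-refl
  det-cong {suc n} h = laplace-cong (h zero) (λ j → det-cong (λ i k → h (suc i) (punchIn j k)))

  det-cast : ∀ {m m′} (r : m ≡ m′) (M : Mat C m m) (N : Mat C m′ m′) →
             (∀ i j → M i j ≈ N (cast r i) (cast r j)) → det R M ≈ det R N
  det-cast refl M N h =
    det-cong (λ i j → ≈-trans (h i j) (≈-reflexive (cong₂ N (cast-is-id refl i) (cast-is-id refl j))))

  detSq-id : ∀ {n} (e : n ≡ n) (M : Mat C n n) → detSq R e M ≈ det R M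
  detSq-id e M = det-cong (λ i j → ≈-reflexive (cong (M i) (cast-is-id e j)))

  detSq-laplace : ∀ {n} (e : suc n ≡ suc n) (M : Mat C (suc n) (suc n)) →
                  detSq R e M ≈ laplace (M zero) (λ j → detSq R refl (λ i k → M (suc i) (punchIn j k)))
  detSq-laplace e M = ≈-trans (detSq-id e M)
    (laplace-congʳ (M zero) (λ j → ≈-sym (detSq-id refl (λ i k → M (suc i) (punchIn j k)))))

  det-expand : ∀ {m n} (e : suc m ≡ n) (M : Mat C (suc m) n) →
               detSq R e M ≈ laplace (M zero) (λ c → det R (λ i k → M (suc i) (minorCol e c k)))
  det-expand refl M = laplace-cong
    (λ j → ≈-reflexive (cong (M zero) (cast-is-id refl j)))
    (λ j → det-cong (λ i k →
      ≈-reflexive (cong (λ c → M (suc i) (cast refl (punchIn c k))) (sym (cast-is-id refl j)))))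

  -- Alternation.  G j l depends only on the pair of columns {j, punchIn j l}
  -- that G j l deletes: deleting j then l is the same as the other order.
  PairSymmetric : ∀ n → (Fin (suc n) → Fin n → C) → Set ℓ
  PairSymmetric zero    G = Lift ℓ ⊤
  PairSymmetric (suc n) G =
    (∀ l → G zero l ≈ G (suc l) zero) × PairSymmetric n (λ j l → G (suc j) (suc l))

  PairSymmetric-resp : ∀ n {G H : Fin (suc n) → Fin n → C} →
                       (∀ j l → G j l ≈ H j l) → PairSymmetric n G → PairSymmetric n H
  PairSymmetric-resp zero    h s = s
  PairSymmetric-resp (suc n) h (s₀ , s) =
      (λ l → ≈-trans (≈-sym (h zero l)) (≈-trans (s₀ l) (h (suc l) zero)))
    , PairSymmetric-resp n (λ j l → h (suc j) (suc l)) s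

  -- Expanding twice along the same row u gives zero: the terms deleting the
  -- same pair of columns in the two orders cancel.
  double-laplace-vanishes : ∀ n (u : Fin (suc n) → C) (G : Fin (suc n) → Fin n → C) →
    PairSymmetric n G → laplace u (λ j → laplace (u ∘ punchIn j) (G j)) ≈ 0#
  double-laplace-vanishes zero    u G _ =
    ≈-trans (+-identityʳ _) (≈-trans (*-identityˡ _) (zeroʳ _))
  double-laplace-vanishes (suc n) u G (s₀ , s) = begin
    laplace u inner                                 ≈⟨ laplace-suc u inner ⟩
    u zero * inner zero + - laplace u′ (inner ∘ suc) ≈⟨ +-cong first (-‿cong rest) ⟩
    Z + - (Z + - 0#)                                ≈⟨ +-congˡ (-‿cong (≈-trans (+-congˡ -0#≈0#) (+-identityʳ Z))) ⟩
    Z + - Z                                         ≈⟨ -‿inverseʳ Z ⟩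
    0#                                              ∎
    where
    u′ : Fin (suc n) → C
    u′ = u ∘ suc
    inner : Fin (suc (suc n)) → C
    inner j = laplace (u ∘ punchIn j) (G j)
    -- terms where column 0 is deleted second
    Z : C
    Z = laplace u′ (λ j → u zero * G (suc j) zero)
    first : u zero * inner zero ≈ Z
    first = ≈-trans (≈-sym (laplace-*ˡ u′ (G zero) (u zero)))
                    (laplace-congʳ u′ {f = λ l → u zero * G zero l} (λ l → *-congˡ (s₀ l)))
    -- terms where column 0 is not deleted
    B : Fin (suc n) → C
    B j = laplace (u′ ∘ punchIn j) (λ l → G (suc j) (suc l))
    rest : laplace u′ (inner ∘ suc) ≈ Z + - 0#
    rest = begin
      laplace u′ (inner ∘ suc)
        ≈⟨ laplace-congʳ u′ (λ j → laplace-suc (u ∘ punchIn (suc j)) (G (suc j))) ⟩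
      laplace u′ (λ j → u zero * G (suc j) zero + - B j)
        ≈⟨ ≈-trans (laplace-+ u′ (λ j → u zero * G (suc j) zero) (λ j → - B j)) (+-congˡ (laplace-neg u′ B)) ⟩
      Z + - laplace u′ B
        ≈⟨ +-congˡ (-‿cong (double-laplace-vanishes n u′ (λ j l → G (suc j) (suc l)) s)) ⟩
      Z + - 0# ∎

  liftFin : ∀ {a b} → (Fin a → Fin b) → Fin (suc a) → Fin (suc b)
  liftFin σ zero    = zero
  liftFin σ (suc k) = suc (σ k)

  punchPairs-symmetric : ∀ n (F : (Fin n → Fin (suc (suc n))) → C) →
    (∀ {σ τ} → (∀ k → σ k ≡ τ k) → F σ ≈ F τ) →
    PairSymmetric (suc n) (λ j l → F (λ k → punchIn j (punchIn l k)))
  punchPairs-symmetric zero    F ext = (λ l → ≈-refl) , lift tt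
  punchPairs-symmetric (suc n) F ext = (λ l → ≈-refl) ,
    PairSymmetric-resp (suc n) (λ j l → ext (lifted j l))
      (punchPairs-symmetric n (F ∘ liftFin) (λ h → ext (liftFin-cong h)))
    where
    lifted : ∀ j l k → liftFin (λ k′ → punchIn j (punchIn l k′)) k ≡ punchIn (suc j) (punchIn (suc l) k)
    lifted j l zero    = refl
    lifted j l (suc k) = refl
    liftFin-cong : ∀ {a b} {σ τ : Fin a → Fin b} → (∀ k → σ k ≡ τ k) → ∀ k → liftFin σ k ≡ liftFin τ k
    liftFin-cong h zero    = refl
    liftFin-cong h (suc k) = cong suc (h k)

  det-equal-rows : ∀ n (M : Mat C (suc (suc n)) (suc (suc n))) →
                   (∀ k → M zero k ≈ M (suc zero) k) → det R M ≈ 0#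
  det-equal-rows n M h = ≈-trans (laplace-cong {f = λ j → det R (minor R M j)} h (λ _ → ≈-refl))
    (double-laplace-vanishes (suc n) (M (suc zero)) (λ j l → F (λ k → punchIn j (punchIn l k)))
      (punchPairs-symmetric n F (λ h′ → det-cong (λ i k → ≈-reflexive (cong (M (suc (suc i))) (h′ k))))))
    where
    F : (Fin n → Fin (suc (suc n))) → C
    F σ = det R (λ i k → M (suc (suc i)) (σ k))

  joinEntry : ∀ {p₁ p₂ q₁ q₂} → Mat C p₁ p₂ → Vect C q₁ → Mat C q₁ q₂ → Vect C q₂ →
              Fin p₁ ⊎ Fin q₁ → Fin p₂ ⊎ Fin q₂ → C
  joinEntry P a Q b (inj₁ i) (inj₁ k) = P i k
  joinEntry P a Q b (inj₁ i) (inj₂ k) = b k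
  joinEntry P a Q b (inj₂ i) (inj₁ k) = a i
  joinEntry P a Q b (inj₂ i) (inj₂ k) = Q i k

  join-entry : ∀ {p₁ p₂ q₁ q₂} (P : Mat C p₁ p₂) (a : Vect C q₁) (Q : Mat C q₁ q₂) (b : Vect C q₂) i k →
               join R P a Q b i k ≡ joinEntry P a Q b (splitAt p₁ i) (splitAt p₂ k)
  join-entry {p₁} {p₂} P a Q b i k with splitAt p₁ i
  ... | inj₁ _ with splitAt p₂ k
  ...   | inj₁ _ = refl
  ...   | inj₂ _ = refl
  join-entry {p₁} {p₂} P a Q b i k | inj₂ _ with splitAt p₂ k
  ...   | inj₁ _ = refl
  ...   | inj₂ _ = refl

  joinDet : ∀ {p₁ p₂ q₁ q₂} → p₁ ℕ+ q₁ ≡ p₂ ℕ+ q₂ →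
            Mat C p₁ p₂ → Vect C q₁ → Mat C q₁ q₂ → Vect C q₂ → C
  joinDet e P a Q b = detSq R e (join R P a Q b)

  dropRow : ∀ {m n} → Mat C (suc m) n → Mat C m n
  dropRow P i k = P (suc i) k

  minorRC : ∀ {m n} → Mat C (suc m) (suc n) → Fin (suc n) → Mat C m n
  minorRC P j i k = P (suc i) (punchIn j k)

  dropCol : ∀ {m n} → Mat C m (suc n) → Fin (suc n) → Mat C m n
  dropCol Q k i x = Q i (punchIn k x)

  dropAt : ∀ {n} → Vect C (suc n) → Fin (suc n) → Vect C n
  dropAt b k x = b (punchIn k x)

  -- For p₁ > 0 the first row of J is (P₀ | b).  Its expansion splits into the
  -- terms through the columns of P, each a minor J(Pⱼ,a;Q,b) ...
  pColumnTerms : ∀ {m₁ p₂ q₁ q₂} → suc m₁ ℕ+ q₁ ≡ p₂ ℕ+ q₂ →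
                 Mat C (suc m₁) p₂ → Vect C q₁ → Mat C q₁ q₂ → Vect C q₂ → C
  pColumnTerms {p₂ = zero}  e P a Q b = 0#
  pColumnTerms {p₂ = suc _} e P a Q b =
    laplace (P zero) (λ j → joinDet (cong pred e) (minorRC P j) a Q b)

  -- ... and the terms through the columns of Q, each a minor J(P′,a;Qₖ,bₖ).
  bColumnTerms : ∀ {m₁ p₂ q₁ q₂} → suc m₁ ℕ+ q₁ ≡ p₂ ℕ+ q₂ →
                 Mat C (suc m₁) p₂ → Vect C q₁ → Mat C q₁ q₂ → Vect C q₂ → C
  bColumnTerms {q₂ = zero} e P a Q b = 0#
  bColumnTerms {p₂ = p₂} {q₂ = suc q₂} e P a Q b =
    laplace b (λ k → joinDet (cong pred (trans e (ℕ.+-suc p₂ q₂))) (dropRow P) a (dropCol Q k) (dropAt b k))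

  joinEntry-minorL : ∀ {p₁ p₂ q₁ q₂} (P : Mat C (suc p₁) (suc p₂)) a (Q : Mat C q₁ q₂) b j s t →
    joinEntry P a Q b (map₁ suc s) (map₁ (punchIn j) t) ≡ joinEntry (minorRC P j) a Q b s t
  joinEntry-minorL P a Q b j (inj₁ _) (inj₁ _) = refl
  joinEntry-minorL P a Q b j (inj₁ _) (inj₂ _) = refl
  joinEntry-minorL P a Q b j (inj₂ _) (inj₁ _) = refl
  joinEntry-minorL P a Q b j (inj₂ _) (inj₂ _) = refl

  joinEntry-minorR : ∀ {p₁ p₂ q₁ q₂} (P : Mat C (suc p₁) p₂) a (Q : Mat C q₁ (suc q₂)) b k s t →
    joinEntry P a Q b (map₁ suc s) (map₂ (punchIn k) t) ≡ joinEntry (dropRow P) a (dropCol Q k) (dropAt b k) s t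
  joinEntry-minorR P a Q b k (inj₁ _) (inj₁ _) = refl
  joinEntry-minorR P a Q b k (inj₁ _) (inj₂ _) = refl
  joinEntry-minorR P a Q b k (inj₂ _) (inj₁ _) = refl
  joinEntry-minorR P a Q b k (inj₂ _) (inj₂ _) = refl

  pColumns : ∀ {m₁ p₂ q₁ q₂} (e : suc m₁ ℕ+ q₁ ≡ p₂ ℕ+ q₂)
    (P : Mat C (suc m₁) p₂) (a : Vect C q₁) (Q : Mat C q₁ q₂) (b : Vect C q₂) → let J = join R P a Q b in
    laplace (λ j → J zero (j ↑ˡ q₂)) (λ j → det R (λ i k → J (suc i) (minorCol e (j ↑ˡ q₂) k)))
      ≈ pColumnTerms e P a Q b
  pColumns {p₂ = zero}                    e P a Q b = ≈-refl
  pColumns {m₁} {suc p₂} {q₁} {q₂} e P a Q b = laplace-cong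
    {x = λ j → join R P a Q b zero (j ↑ˡ q₂)} {y = P zero}
    {f = λ j → det R (λ i k → join R P a Q b (suc i) (minorCol e (j ↑ˡ q₂) k))}
    {g = λ j → joinDet (cong pred e) (minorRC P j) a Q b}
    (λ j → ≈-reflexive (trans (join-entry P a Q b zero (j ↑ˡ q₂))
                              (cong (joinEntry P a Q b (inj₁ zero)) (splitAt-↑ˡ (suc p₂) j q₂))))
    (λ j → det-cong (λ i k → begin
      join R P a Q b (suc i) (minorCol e (j ↑ˡ q₂) k)
        ≡⟨ join-entry P a Q b (suc i) _ ⟩
      joinEntry P a Q b (map₁ suc (splitAt m₁ i)) (splitAt (suc p₂) (minorCol e (j ↑ˡ q₂) k))
        ≡⟨ cong (joinEntry P a Q b (map₁ suc (splitAt m₁ i))) (minorCol-↑ˡ p₂ j e (cong pred e) k) ⟩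
      joinEntry P a Q b (map₁ suc (splitAt m₁ i)) (map₁ (punchIn j) (splitAt p₂ (cast (cong pred e) k)))
        ≡⟨ joinEntry-minorL P a Q b j (splitAt m₁ i) _ ⟩
      joinEntry (minorRC P j) a Q b (splitAt m₁ i) (splitAt p₂ (cast (cong pred e) k))
        ≡⟨ join-entry (minorRC P j) a Q b i _ ⟨
      join R (minorRC P j) a Q b i (cast (cong pred e) k) ∎))

  bColumns : ∀ {m₁ p₂ q₁ q₂} (e : suc m₁ ℕ+ q₁ ≡ p₂ ℕ+ q₂)
    (P : Mat C (suc m₁) p₂) (a : Vect C q₁) (Q : Mat C q₁ q₂) (b : Vect C q₂) → let J = join R P a Q b in
    laplace (λ k → J zero (p₂ ↑ʳ k)) (λ k → det R (λ i x → J (suc i) (minorCol e (p₂ ↑ʳ k) x)))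
      ≈ bColumnTerms e P a Q b
  bColumns {q₂ = zero}                    e P a Q b = ≈-refl
  bColumns {m₁} {p₂} {q₁} {suc q₂} e P a Q b = laplace-cong
    {x = λ k → join R P a Q b zero (p₂ ↑ʳ k)} {y = b}
    {f = λ k → det R (λ i x → join R P a Q b (suc i) (minorCol e (p₂ ↑ʳ k) x))}
    {g = λ k → joinDet e₂ (dropRow P) a (dropCol Q k) (dropAt b k)}
    (λ k → ≈-reflexive (trans (join-entry P a Q b zero (p₂ ↑ʳ k))
                              (cong (joinEntry P a Q b (inj₁ zero)) (splitAt-↑ʳ p₂ (suc q₂) k))))
    (λ k → det-cong (λ i x → begin
      join R P a Q b (suc i) (minorCol e (p₂ ↑ʳ k) x)
        ≡⟨ join-entry P a Q b (suc i) _ ⟩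
      joinEntry P a Q b (map₁ suc (splitAt m₁ i)) (splitAt p₂ (minorCol e (p₂ ↑ʳ k) x))
        ≡⟨ cong (joinEntry P a Q b (map₁ suc (splitAt m₁ i))) (minorCol-↑ʳ p₂ k e e₂ x) ⟩
      joinEntry P a Q b (map₁ suc (splitAt m₁ i)) (map₂ (punchIn k) (splitAt p₂ (cast e₂ x)))
        ≡⟨ joinEntry-minorR P a Q b k (splitAt m₁ i) _ ⟩
      joinEntry (dropRow P) a (dropCol Q k) (dropAt b k) (splitAt m₁ i) (splitAt p₂ (cast e₂ x))
        ≡⟨ join-entry (dropRow P) a (dropCol Q k) (dropAt b k) i _ ⟨
      join R (dropRow P) a (dropCol Q k) (dropAt b k) i (cast e₂ x) ∎))
    where
    e₂ : m₁ ℕ+ q₁ ≡ p₂ ℕ+ q₂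
    e₂ = cong pred (trans e (ℕ.+-suc p₂ q₂))

  -- First-row expansion of a join: joins are closed under first-row minors.
  joinDet-expand : ∀ {m₁ p₂ q₁ q₂} (e : suc m₁ ℕ+ q₁ ≡ p₂ ℕ+ q₂)
    (P : Mat C (suc m₁) p₂) (a : Vect C q₁) (Q : Mat C q₁ q₂) (b : Vect C q₂) →
    joinDet e P a Q b ≈ pColumnTerms e P a Q b + signℕ p₂ * bColumnTerms e P a Q b
  joinDet-expand {p₂ = p₂} {q₂ = q₂} e P a Q b =
    ≈-trans (det-expand e J)
   (≈-trans (laplace-split p₂ q₂ (J zero) minorDet)
            (+-cong (pColumns e P a Q b) (*-congˡ (bColumns e P a Q b))))
    where
    J = join R P a Q b
    minorDet : Fin (p₂ ℕ+ q₂) → C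
    minorDet c = det R (λ i k → J (suc i) (minorCol e c k))

  joinDet-noQ : ∀ {m} (e : m ℕ+ 0 ≡ m ℕ+ 0) (P : Mat C m m) (a : Vect C 0) (Q : Mat C 0 0) (b : Vect C 0) →
                joinDet e P a Q b ≈ det R P
  joinDet-noQ {m} e P a Q b = det-cast r _ P (λ i j → begin
    join R P a Q b i (cast e j)
      ≡⟨ join-entry P a Q b i (cast e j) ⟩
    joinEntry P a Q b (splitAt m i) (splitAt m (cast e j))
      ≡⟨ cong₂ (joinEntry P a Q b) (splitAt-+0 m i) (splitAt-+0 m (cast e j)) ⟩
    P (cast r i) (cast r (cast e j))
      ≡⟨ cong (P (cast r i)) (cast-trans e r j) ⟩
    P (cast r i) (cast r j) ∎)
    where
    r : m ℕ+ 0 ≡ m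
    r = ℕ.+-identityʳ m

  joinDet-noRows : ∀ {p₂ q₁ q₂} (e : q₁ ≡ p₂ ℕ+ q₂) (P P′ : Mat C 0 p₂) a (Q : Mat C q₁ q₂) b →
                   joinDet e P a Q b ≈ joinDet e P′ a Q b
  joinDet-noRows {p₂} e P P′ a Q b = det-cong (λ i x → begin
    join R P a Q b i (cast e x)                          ≡⟨ join-entry P a Q b i (cast e x) ⟩
    joinEntry P a Q b (inj₂ i) (splitAt p₂ (cast e x))   ≡⟨ lowerRows (splitAt p₂ (cast e x)) ⟩
    joinEntry P′ a Q b (inj₂ i) (splitAt p₂ (cast e x))  ≡⟨ join-entry P′ a Q b i (cast e x) ⟨
    join R P′ a Q b i (cast e x)                         ∎)
    where
    lowerRows : ∀ {i} t → joinEntry P a Q b (inj₂ i) t ≡ joinEntry P′ a Q b (inj₂ i) t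
    lowerRows (inj₁ _) = refl
    lowerRows (inj₂ _) = refl

  joinDet-reread : ∀ {p₂ q q₂} (e : suc q ≡ p₂ ℕ+ q₂) (P : Mat C 0 p₂) (a : Vect C (suc q))
                   (Q : Mat C (suc q) q₂) (b : Vect C q₂) →
                   joinDet e P a Q b ≈ joinDet e (λ _ _ → a zero) (a ∘ suc) (dropRow Q) (Q zero)
  joinDet-reread {p₂} e P a Q b = det-cong (λ i x → begin
    join R P a Q b i (cast e x)
      ≡⟨ join-entry P a Q b i (cast e x) ⟩
    joinEntry P a Q b (inj₂ i) (splitAt p₂ (cast e x))
      ≡⟨ reread i (splitAt p₂ (cast e x)) ⟩
    joinEntry P′ (a ∘ suc) (dropRow Q) (Q zero) (splitAt 1 i) (splitAt p₂ (cast e x))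
      ≡⟨ join-entry P′ (a ∘ suc) (dropRow Q) (Q zero) i (cast e x) ⟨
    join R P′ (a ∘ suc) (dropRow Q) (Q zero) i (cast e x) ∎)
    where
    P′ : Mat C 1 p₂
    P′ _ _ = a zero
    reread : ∀ i t → joinEntry P a Q b (inj₂ i) t ≡ joinEntry P′ (a ∘ suc) (dropRow Q) (Q zero) (splitAt 1 i) t
    reread zero    (inj₁ _) = refl
    reread zero    (inj₂ _) = refl
    reread (suc i) (inj₁ _) = refl
    reread (suc i) (inj₂ _) = refl

  -- Two zero rows on top: the first two rows (0 | b) of the join coincide.
  joinDet-zeroRows : ∀ {p₂ q₁ q₂} (e : 2 ℕ+ q₁ ≡ p₂ ℕ+ q₂) a (Q : Mat C q₁ q₂) b →
                     joinDet e (zeros R) a Q b ≈ 0#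
  joinDet-zeroRows {p₂} {q₁} e a Q b = det-equal-rows q₁ (λ i j → J i (cast e j)) (λ k → begin
    J zero (cast e k)                                    ≡⟨ join-entry Z a Q b zero (cast e k) ⟩
    joinEntry Z a Q b (inj₁ zero) (splitAt p₂ (cast e k))       ≡⟨ topRows (splitAt p₂ (cast e k)) ⟩
    joinEntry Z a Q b (inj₁ (suc zero)) (splitAt p₂ (cast e k)) ≡⟨ join-entry Z a Q b (suc zero) (cast e k) ⟨
    J (suc zero) (cast e k)                              ∎)
    where
    Z : Mat C 2 p₂
    Z = zeros R
    J = join R Z a Q b
    topRows : ∀ t → joinEntry Z a Q b (inj₁ zero) t ≡ joinEntry Z a Q b (inj₁ (suc zero)) t
    topRows (inj₁ _) = refl
    topRows (inj₂ _) = refl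

  pColumnTerms-zeros : ∀ {m₁ p₂ q₁ q₂} (e : suc m₁ ℕ+ q₁ ≡ p₂ ℕ+ q₂) a (Q : Mat C q₁ q₂) b →
                       pColumnTerms e (zeros R) a Q b ≈ 0#
  pColumnTerms-zeros {p₂ = zero}  e a Q b = ≈-refl
  pColumnTerms-zeros {p₂ = suc _} e a Q b =
    laplace-vanish (λ _ → 0#) (λ j → joinDet (cong pred e) (minorRC (zeros R) j) a Q b) (λ _ → zeroˡ _)

  -- Hence the Q-column part of the expansion of J(0₂ₓₚ,a;Q,b) vanishes; this
  -- is the alternating sum Σₖ ±bₖ det J(0₁ₓₚ,a;Qₖ,bₖ).
  bColumnTerms-zeros : ∀ {p₂ q₁ q₂} (e : 2 ℕ+ q₁ ≡ p₂ ℕ+ q₂) a (Q : Mat C q₁ q₂) b →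
                       bColumnTerms e (zeros R) a Q b ≈ 0#
  bColumnTerms-zeros {p₂} e a Q b = begin
    X                   ≈⟨ *-identityˡ X ⟨
    1# * X              ≈⟨ *-congʳ (signℕ-square p₂) ⟨
    (σ * σ) * X         ≈⟨ *-assoc σ σ X ⟩
    σ * (σ * X)         ≈⟨ *-congˡ σX≈0 ⟩
    σ * 0#              ≈⟨ zeroʳ σ ⟩
    0#                  ∎
    where
    σ = signℕ p₂
    X = bColumnTerms e (zeros R) a Q b
    σX≈0 : σ * X ≈ 0#
    σX≈0 = begin
      σ * X                                     ≈⟨ +-identityˡ _ ⟨
      0# + σ * X                                ≈⟨ +-congʳ (pColumnTerms-zeros e a Q b) ⟨
      pColumnTerms e (zeros R) a Q b + σ * X    ≈⟨ joinDet-expand e (zeros R) a Q b ⟨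
      joinDet e (zeros R) a Q b                 ≈⟨ joinDet-zeroRows e a Q b ⟩
      0#                                        ∎

  -- If P has no rows and at least two columns, J = [aᵀ1 | Q] has two equal
  -- columns and vanishes.
  repeated-column : ∀ q₁ {p q₂} (e : q₁ ≡ suc (suc p) ℕ+ q₂) (P : Mat C 0 (suc (suc p)))
                    (a : Vect C q₁) (Q : Mat C q₁ q₂) (b : Vect C q₂) → joinDet e P a Q b ≈ 0#
  repeated-column zero    () P a Q b
  repeated-column (suc q) {p} {q₂} e P a Q b = begin
    joinDet e P a Q b                       ≈⟨ joinDet-reread e P a Q b ⟩
    joinDet e P′ a′ Q′ (Q zero)             ≈⟨ joinDet-expand e P′ a′ Q′ (Q zero) ⟩
    pColumnTerms e P′ a′ Q′ (Q zero) + signℕ (suc (suc p)) * bColumnTerms e P′ a′ Q′ (Q zero)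
      ≈⟨ +-cong (pColumnsVanish p e) (*-congˡ (bColumnsVanish q₂ e Q)) ⟩
    0# + signℕ (suc (suc p)) * 0#           ≈⟨ ≈-trans (+-identityˡ _) (zeroʳ _) ⟩
    0#                                      ∎
    where
    a′ = a ∘ suc
    Q′ = dropRow Q
    P′ : ∀ {n} → Mat C 1 n
    P′ _ _ = a zero
    -- the minors through the columns of P′ cancel in pairs, or vanish by induction
    pColumnsVanish : ∀ p (e : suc q ≡ suc (suc p) ℕ+ q₂) → pColumnTerms e P′ a′ Q′ (Q zero) ≈ 0#
    pColumnsVanish zero e = begin
      laplace (P′ zero) D                            ≈⟨ laplace-suc (P′ zero) D ⟩
      a zero * D zero + - laplace (P′ zero ∘ suc) (D ∘ suc)
        ≈⟨ +-congˡ (-‿cong (laplace-single (P′ zero ∘ suc) (D ∘ suc))) ⟩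
      a zero * D zero + - (a zero * D (suc zero))
        ≈⟨ +-congˡ (-‿cong (*-congˡ
             (joinDet-noRows (cong pred e) (minorRC P′ (suc zero)) (minorRC P′ zero) a′ Q′ (Q zero)))) ⟩
      a zero * D zero + - (a zero * D zero)          ≈⟨ -‿inverseʳ _ ⟩
      0#                                             ∎
      where
      D : Fin 2 → C
      D j = joinDet (cong pred e) (minorRC P′ j) a′ Q′ (Q zero)
    pColumnsVanish (suc p) e = laplace-vanish (P′ zero) _ (λ j →
      ≈-trans (*-congˡ (repeated-column q (cong pred e) (minorRC P′ j) a′ Q′ (Q zero))) (zeroʳ _))
    bColumnsVanish : ∀ q₂ (e : suc q ≡ suc (suc p) ℕ+ q₂) (Q : Mat C (suc q) q₂) →
                     bColumnTerms e P′ a′ (dropRow Q) (Q zero) ≈ 0#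
    bColumnsVanish zero     e Q = ≈-refl
    bColumnsVanish (suc q₂) e Q = laplace-vanish (Q zero) _ (λ k → ≈-trans (*-congˡ
      (repeated-column q {p} (cong pred (trans e (ℕ.+-suc (suc (suc p)) q₂)))
                       (dropRow P′) a′ (dropCol (dropRow Q) k) (dropAt (Q zero) k)))
      (zeroʳ _))

  𝟙 : ∀ {n} → Vect C n
  𝟙 _ = 1#

  -- The auxiliary determinants of the theorem, as joins with a zero block:
  --   bordered P   = det [P 1ᵀ; 1 0]      cornered a Q b = det [0 b; aᵀ Q]
  --   onesColumn P = det [P 1ᵀ]           bRow a Q b     = det [b; Q]
  --   onesRow P    = det [P; 1]           aColumn a Q b  = det [aᵀ Q]
  -- (bRow does not involve a, nor aColumn b: they sit in empty blocks.)
  bordered : ∀ {p₁ p₂} → p₁ ℕ+ 1 ≡ p₂ ℕ+ 1 → Mat C p₁ p₂ → C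
  bordered e P = joinDet e P 𝟙 (zeros R {1} {1}) 𝟙

  cornered : ∀ {q₁ q₂} → 1 ℕ+ q₁ ≡ 1 ℕ+ q₂ → Vect C q₁ → Mat C q₁ q₂ → Vect C q₂ → C
  cornered e a Q b = joinDet e (zeros R {1} {1}) a Q b

  onesColumn : ∀ {p₁ p₂} → p₁ ℕ+ 0 ≡ p₂ ℕ+ 1 → Mat C p₁ p₂ → C
  onesColumn e P = joinDet e P 𝟙 (zeros R {0} {1}) 𝟙

  bRow : ∀ {q₁ q₂} → 1 ℕ+ q₁ ≡ 0 ℕ+ q₂ → Vect C q₁ → Mat C q₁ q₂ → Vect C q₂ → C
  bRow e a Q b = joinDet e (zeros R {1} {0}) a Q b

  onesRow : ∀ {p₁ p₂} → p₁ ℕ+ 1 ≡ p₂ ℕ+ 0 → Mat C p₁ p₂ → C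
  onesRow e P = joinDet e P 𝟙 (zeros R {1} {0}) 𝟙

  aColumn : ∀ {q₁ q₂} → 0 ℕ+ q₁ ≡ 1 ℕ+ q₂ → Vect C q₁ → Mat C q₁ q₂ → Vect C q₂ → C
  aColumn e a Q b = joinDet e (zeros R {0} {1}) a Q b

  -- First-row expansions of the auxiliary determinants.  The last column of
  -- [P 1ᵀ; 1 0] contributes [P′; 1]; that of [P 1ᵀ] contributes det P′.
  bordered-expand : ∀ {m} (e : suc m ℕ+ 1 ≡ suc m ℕ+ 1) (P : Mat C (suc m) (suc m)) →
    bordered e P ≈ laplace (P zero) (λ j → bordered refl (minorRC P j))
                   + signℕ (suc m) * onesRow (ℕ.+-suc m 0) (dropRow P)
  bordered-expand {m} e P = ≈-trans (joinDet-expand e P 𝟙 (zeros R) 𝟙)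
    (+-congˡ (*-congˡ (≈-trans (laplace-single 𝟙 (λ _ → onesRow (ℕ.+-suc m 0) (dropRow P))) (*-identityˡ _))))

  onesColumn-expand : ∀ {m} (e : suc m ℕ+ 0 ≡ m ℕ+ 1) (P : Mat C (suc m) m) →
    onesColumn e P ≈ pColumnTerms e P 𝟙 (zeros R) 𝟙 + signℕ m * det R (dropRow P)
  onesColumn-expand {m} e P = ≈-trans (joinDet-expand e P 𝟙 (zeros R) 𝟙)
    (+-congˡ (*-congˡ (≈-trans
      (laplace-single 𝟙 (λ _ → joinDet {q₁ = 0} {q₂ = 0} refl (dropRow P) 𝟙 (zeros R {0} {0}) 𝟙))
      (≈-trans (*-identityˡ _) (joinDet-noQ refl (dropRow P) 𝟙 (zeros R) 𝟙)))))

  -- The first rows of [0 b; aᵀ Q] and [b; Q] are (0 | b) and b: both expand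
  -- to the signed sum over the b-column minors.
  cornered-expand : ∀ {q₁ q₂} (e : 1 ℕ+ q₁ ≡ 1 ℕ+ q₂) a (Q : Mat C q₁ q₂) b →
                    cornered e a Q b ≈ - bColumnTerms e (zeros R) a Q b
  cornered-expand e a Q b = begin
    cornered e a Q b                          ≈⟨ joinDet-expand e (zeros R) a Q b ⟩
    pColumnTerms e (zeros R) a Q b + - 1# * S ≈⟨ +-cong (pColumnTerms-zeros e a Q b) (-1*x≈-x S) ⟩
    0# + - S                                  ≈⟨ +-identityˡ _ ⟩
    - S                                       ∎
    where
    S = bColumnTerms e (zeros R) a Q b

  bRow-expand : ∀ {q₁ q₂} (e : 1 ℕ+ q₁ ≡ 0 ℕ+ q₂) a (Q : Mat C q₁ q₂) b →
                bRow e a Q b ≈ bColumnTerms e (zeros R) a Q b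
  bRow-expand e a Q b =
    ≈-trans (joinDet-expand e (zeros R) a Q b) (≈-trans (+-identityˡ _) (*-identityˡ _))

  record JoinFormula {p₁ p₂ q₁ q₂} (e : p₁ ℕ+ q₁ ≡ p₂ ℕ+ q₂) (P : Mat C p₁ p₂)
                     (a : Vect C q₁) (Q : Mat C q₁ q₂) (b : Vect C q₂) : Set ℓ where
    field
      square    : (h : p₁ ≡ p₂) → joinDet e P a Q b ≈
                  detSq R h P * detSq R (dim₁ e h) Q
                  + - (bordered (cong (_ℕ+ 1) h) P * cornered (cong (1 ℕ+_) (dim₁ e h)) a Q b)
      tall      : (h : p₁ ≡ p₂ ℕ+ 1) →
                  joinDet e P a Q b ≈ onesColumn (trans (ℕ.+-identityʳ p₁) h) P * bRow (dim₂ e h) a Q b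
      wide      : (h : p₂ ≡ p₁ ℕ+ 1) →
                  joinDet e P a Q b ≈ onesRow (trans (sym h) (sym (ℕ.+-identityʳ p₂))) P * aColumn (dim₃ e h) a Q b
      otherwise : p₁ ≢ p₂ → p₁ ≢ p₂ ℕ+ 1 → p₂ ≢ p₁ ℕ+ 1 → joinDet e P a Q b ≈ 0#

  open JoinFormula

  joinFormula-base : ∀ {p₂ q₁ q₂} (e : q₁ ≡ p₂ ℕ+ q₂) (P : Mat C 0 p₂) a (Q : Mat C q₁ q₂) b →
                     JoinFormula e P a Q b
  joinFormula-base {p₂} {q₁} e P a Q b = record
    { square    = λ h → squareCase h (dim₁ e h) e P Q b
    ; tall      = λ h → ⊥-elim (ℕ.0≢1+n (trans h (ℕ.+-comm p₂ 1)))
    ; wide      = λ h → wideCase h e P Q b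
    ; otherwise = otherwiseCase e P Q b
    }
    where
    -- J = Q, while [P 1ᵀ; 1 0] = [0].
    squareCase : ∀ {p₂ q₂} (h : 0 ≡ p₂) (d : q₁ ≡ q₂) (e : q₁ ≡ p₂ ℕ+ q₂)
                 (P : Mat C 0 p₂) (Q : Mat C q₁ q₂) (b : Vect C q₂) →
                 joinDet e P a Q b ≈ detSq R h P * detSq R d Q
                   + - (bordered (cong (_ℕ+ 1) h) P * cornered (cong (1 ℕ+_) d) a Q b)
    squareCase refl refl e P Q b = begin
      detSq R e Q                  ≈⟨ *-identityˡ _ ⟨
      1# * detSq R e Q             ≈⟨ +-identityʳ _ ⟨
      1# * detSq R e Q + 0#        ≈⟨ +-congˡ (≈-trans (-‿cong (≈-trans (*-congʳ borderZero) (zeroˡ _))) -0#≈0#) ⟨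
      1# * detSq R e Q + - (bordered refl P * cornered refl a Q b) ∎
      where
      borderZero : bordered refl P ≈ 0#
      borderZero = ≈-trans (laplace-single (λ _ → 0#) (λ _ → 1#)) (zeroˡ _)
    -- J = [aᵀ Q], while [P; 1] = [1].
    wideCase : ∀ {p₂ q₂} (h : p₂ ≡ 0 ℕ+ 1) (e : q₁ ≡ p₂ ℕ+ q₂)
               (P : Mat C 0 p₂) (Q : Mat C q₁ q₂) (b : Vect C q₂) →
               joinDet e P a Q b ≈ onesRow (trans (sym h) (sym (ℕ.+-identityʳ p₂))) P * aColumn (dim₃ e h) a Q b
    wideCase refl e P Q b = begin
      joinDet e P a Q b                     ≈⟨ joinDet-noRows e P (zeros R) a Q b ⟩
      aColumn e a Q b                       ≈⟨ *-identityˡ _ ⟨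
      1# * aColumn e a Q b                  ≈⟨ *-congʳ (≈-trans (laplace-single (λ _ → 1#) (λ _ → 1#)) (*-identityˡ _)) ⟨
      onesRow refl P * aColumn e a Q b      ∎
    otherwiseCase : ∀ {p₂ q₂} (e : q₁ ≡ p₂ ℕ+ q₂) (P : Mat C 0 p₂) (Q : Mat C q₁ q₂) (b : Vect C q₂) →
                    0 ≢ p₂ → 0 ≢ p₂ ℕ+ 1 → p₂ ≢ 0 ℕ+ 1 → joinDet e P a Q b ≈ 0#
    otherwiseCase {zero}        e P Q b n₁ n₂ n₃ = ⊥-elim (n₁ refl)
    otherwiseCase {suc zero}    e P Q b n₁ n₂ n₃ = ⊥-elim (n₃ refl)
    otherwiseCase {suc (suc p)} e P Q b n₁ n₂ n₃ = repeated-column _ e P a Q b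

  Hypothesis : ℕ → Set (c ⊔ ℓ)
  Hypothesis m = ∀ {p₂ q₁ q₂} (e : m ℕ+ q₁ ≡ p₂ ℕ+ q₂) (P : Mat C m p₂) (a : Vect C q₁)
                 (Q : Mat C q₁ q₂) (b : Vect C q₂) → JoinFormula e P a Q b

  -- The P-columns give det P det Q − (Σⱼ ±P₀ⱼ [Pⱼ 1ᵀ;1 0]) E by
  -- induction, with E = [0 b; aᵀ Q]; the b-columns give [P′;1] Σₖ ±bₖ [aᵀ Qₖ]
  -- = −[P′;1] E, exactly the last-column term of the expansion of [P 1ᵀ;1 0].
  square-step : ∀ m → Hypothesis m → ∀ {q} (e : suc m ℕ+ q ≡ suc m ℕ+ q) (P : Mat C (suc m) (suc m))
                (a : Vect C q) (Q : Mat C q q) (b : Vect C q) →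
    joinDet e P a Q b ≈ detSq R refl P * detSq R refl Q + - (bordered refl P * cornered refl a Q b)
  square-step m IH {q} e P a Q b = begin
    joinDet e P a Q b                                        ≈⟨ joinDet-expand e P a Q b ⟩
    pColumnTerms e P a Q b + σ * bColumnTerms e P a Q b      ≈⟨ +-cong pTerms (*-congˡ (bTerms e a Q b)) ⟩
    (dP * dQ + - (B′ * E)) + σ * (R′ * S)                    ≈⟨ +-congˡ (*-congˡ (*-congˡ S≈-E)) ⟩
    (dP * dQ + - (B′ * E)) + σ * (R′ * - E)                  ≈⟨ collect (dP * dQ) B′ E σ R′ ⟩
    dP * dQ + - ((B′ + σ * R′) * E)                          ≈⟨ +-congˡ (-‿cong (*-congʳ (bordered-expand refl P))) ⟨
    dP * dQ + - (bordered refl P * E)                        ∎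
    where
    σ = signℕ (suc m)
    dP = detSq R refl P
    dQ = detSq R refl Q
    E = cornered refl a Q b
    S = bColumnTerms refl (zeros R) a Q b
    R′ = onesRow (ℕ.+-suc m 0) (dropRow P)
    dⱼ Bⱼ : Fin (suc m) → C
    dⱼ j = detSq R refl (minorRC P j)
    Bⱼ j = bordered refl (minorRC P j)
    B′ = laplace (P zero) Bⱼ

    S≈-E : S ≈ - E
    S≈-E = ≈-trans (≈-sym (-‿involutive S)) (-‿cong (≈-sym (cornered-expand refl a Q b)))

    pTerms : pColumnTerms e P a Q b ≈ dP * dQ + - (B′ * E)
    pTerms = begin
      laplace (P zero) (λ j → joinDet (cong pred e) (minorRC P j) a Q b)
        ≈⟨ laplace-congʳ (P zero) (λ j → square (IH (cong pred e) (minorRC P j) a Q b) refl) ⟩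
      laplace (P zero) (λ j → dⱼ j * dQ + - (Bⱼ j * E))
        ≈⟨ laplace-+ (P zero) (λ j → dⱼ j * dQ) (λ j → - (Bⱼ j * E)) ⟩
      laplace (P zero) (λ j → dⱼ j * dQ) + laplace (P zero) (λ j → - (Bⱼ j * E))
        ≈⟨ +-cong (laplace-*ʳ (P zero) dⱼ dQ)
                  (≈-trans (laplace-neg (P zero) (λ j → Bⱼ j * E)) (-‿cong (laplace-*ʳ (P zero) Bⱼ E))) ⟩
      laplace (P zero) dⱼ * dQ + - (B′ * E)
        ≈⟨ +-congʳ (*-congʳ (detSq-laplace refl P)) ⟨
      dP * dQ + - (B′ * E) ∎

    -- the b-column minors J(P′,a;Qₖ,bₖ) are wide: P′ is m × (m+1)
    bTerms : ∀ {q} (e : suc m ℕ+ q ≡ suc m ℕ+ q) a (Q : Mat C q q) b →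
             bColumnTerms e P a Q b ≈ R′ * bColumnTerms refl (zeros R) a Q b
    bTerms {zero}  e a Q b = ≈-sym (zeroʳ R′)
    bTerms {suc q} e a Q b = ≈-trans
      (laplace-congʳ b (λ k → wide (IH (cong pred (trans e (ℕ.+-suc (suc m) q))) (dropRow P) a (dropCol Q k) (dropAt b k))
                                   (ℕ.+-comm 1 m)))
      (laplace-*ˡ b (λ k → aColumn refl a (dropCol Q k) (dropAt b k)) R′)

    collect : ∀ x y e s r → (x + - (y * e)) + s * (r * - e) ≈ x + - ((y + s * r) * e)
    collect x y e s r = begin
      (x + - (y * e)) + s * (r * - e)   ≈⟨ +-assoc _ _ _ ⟩
      x + (- (y * e) + s * (r * - e))
        ≈⟨ +-congˡ (+-congˡ (≈-trans (≈-sym (*-assoc s r (- e))) (≈-sym (-‿distribʳ-* (s * r) e)))) ⟩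
      x + (- (y * e) + - (s * r * e))   ≈⟨ +-congˡ (-‿+-comm _ _) ⟩
      x + - (y * e + s * r * e)         ≈⟨ +-congˡ (-‿cong (distribʳ e y (s * r))) ⟨
      x + - ((y + s * r) * e)           ∎

  -- p₁ = p₂ + 1.  The P-columns give (Σⱼ ±P₀ⱼ [Pⱼ 1ᵀ]) [b;Q] by induction; the
  -- b-column minors are square and give det P′ Σₖ ±bₖ det Qₖ = det P′ [b;Q]
  -- (their second halves sum to an expansion with two equal rows).  Together
  -- this is the expansion of [P 1ᵀ] times [b;Q].
  tall-step : ∀ m → Hypothesis m → ∀ {q} (e : suc m ℕ+ q ≡ m ℕ+ suc q) (P : Mat C (suc m) m)
              (a : Vect C q) (Q : Mat C q (suc q)) (b : Vect C (suc q)) →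
    joinDet e P a Q b ≈ onesColumn (trans (ℕ.+-identityʳ (suc m)) (ℕ.+-comm 1 m)) P * bRow refl a Q b
  tall-step m IH {q} e P a Q b = begin
    joinDet e P a Q b                                     ≈⟨ joinDet-expand e P a Q b ⟩
    pColumnTerms e P a Q b + σ * bColumnTerms e P a Q b   ≈⟨ +-cong (pTerms m IH e P) (*-congˡ bTerms) ⟩
    T * G + σ * (det R P′ * G)                            ≈⟨ +-congˡ (*-assoc σ _ G) ⟨
    T * G + σ * det R P′ * G                              ≈⟨ distribʳ G T _ ⟨
    (T + σ * det R P′) * G                                ≈⟨ *-congʳ (onesColumn-expand e₀ P) ⟨
    onesColumn e₀ P * G                                   ∎
    where
    e₀ : suc m ℕ+ 0 ≡ m ℕ+ 1
    e₀ = trans (ℕ.+-identityʳ (suc m)) (ℕ.+-comm 1 m)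
    σ = signℕ m
    G = bRow refl a Q b
    T = pColumnTerms e₀ P 𝟙 (zeros R) 𝟙
    P′ = dropRow P
    e′ : m ℕ+ q ≡ m ℕ+ q
    e′ = cong pred (trans e (ℕ.+-suc m q))

    -- the P-column minors J(Pⱼ,a;Q,b) are tall
    pTerms : ∀ m → Hypothesis m → (e : suc m ℕ+ q ≡ m ℕ+ suc q) (P : Mat C (suc m) m) →
             pColumnTerms e P a Q b
               ≈ pColumnTerms (trans (ℕ.+-identityʳ (suc m)) (ℕ.+-comm 1 m)) P 𝟙 (zeros R) 𝟙 * G
    pTerms zero    IH e P = ≈-sym (zeroˡ G)
    pTerms (suc m) IH e P = ≈-trans
      (laplace-congʳ (P zero) (λ j → tall (IH (cong pred e) (minorRC P j) a Q b) (ℕ.+-comm 1 m)))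
      (laplace-*ʳ (P zero) (λ j → onesColumn (trans (ℕ.+-identityʳ (suc m)) (ℕ.+-comm 1 m)) (minorRC P j)) G)

    -- the b-column minors J(P′,a;Qₖ,bₖ) are square
    bTerms : bColumnTerms e P a Q b ≈ det R P′ * G
    bTerms = begin
      laplace b (λ k → joinDet e′ P′ a (dropCol Q k) (dropAt b k))
        ≈⟨ laplace-congʳ b (λ k → square (IH e′ P′ a (dropCol Q k) (dropAt b k)) refl) ⟩
      laplace b (λ k → dP′ * dQ k + - (B * Eₖ k))
        ≈⟨ laplace-+ b (λ k → dP′ * dQ k) (λ k → - (B * Eₖ k)) ⟩
      laplace b (λ k → dP′ * dQ k) + laplace b (λ k → - (B * Eₖ k))
        ≈⟨ +-cong (laplace-*ˡ b dQ dP′) (≈-trans (laplace-neg b (λ k → B * Eₖ k)) (-‿cong (laplace-*ˡ b Eₖ B))) ⟩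
      dP′ * laplace b dQ + - (B * laplace b Eₖ)
        ≈⟨ +-cong (*-cong (detSq-id refl P′) (≈-sym (bRow-expand refl a Q b)))
                  (≈-trans (-‿cong (≈-trans (*-congˡ (bColumnTerms-zeros {p₂ = 1} refl a Q b)) (zeroʳ B))) -0#≈0#) ⟩
      det R P′ * G + 0#
        ≈⟨ +-identityʳ _ ⟩
      det R P′ * G ∎
      where
      dP′ = detSq R refl P′
      B = bordered refl P′
      dQ Eₖ : Fin (suc q) → C
      dQ k = detSq R refl (dropCol Q k)
      Eₖ k = cornered refl a (dropCol Q k) (dropAt b k)

  -- p₂ = p₁ + 1.  The P-columns give (Σⱼ ±P₀ⱼ [Pⱼ;1]) [aᵀ Q] by induction, which
  -- is [P;1] [aᵀ Q]; the b-column minors J(P′,a;Qₖ,bₖ) have p₂ = p₁′ + 2 and vanish.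
  wide-step : ∀ m → Hypothesis m → ∀ {q} (e : suc m ℕ+ suc q ≡ suc (m ℕ+ 1) ℕ+ q)
              (P : Mat C (suc m) (suc (m ℕ+ 1))) (a : Vect C (suc q)) (Q : Mat C (suc q) q) (b : Vect C q) →
    joinDet e P a Q b ≈ onesRow (sym (ℕ.+-identityʳ (suc m ℕ+ 1))) P * aColumn refl a Q b
  wide-step m IH {q} e P a Q b = begin
    joinDet e P a Q b                                     ≈⟨ joinDet-expand e P a Q b ⟩
    pColumnTerms e P a Q b + σ * bColumnTerms e P a Q b   ≈⟨ +-cong pTerms (*-congˡ (bTerms e a Q b)) ⟩
    T * L + σ * 0#                                        ≈⟨ +-congˡ (≈-trans (zeroʳ σ) (≈-sym (zeroˡ L))) ⟩
    T * L + 0# * L                                        ≈⟨ distribʳ L T 0# ⟨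
    (T + 0#) * L                                          ≈⟨ *-congʳ (+-congˡ (zeroʳ σ)) ⟨
    (T + σ * 0#) * L                                      ≈⟨ *-congʳ (joinDet-expand e₀ P 𝟙 (zeros R) 𝟙) ⟨
    onesRow e₀ P * L                                      ∎
    where
    e₀ : suc m ℕ+ 1 ≡ suc (m ℕ+ 1) ℕ+ 0
    e₀ = sym (ℕ.+-identityʳ (suc m ℕ+ 1))
    σ = signℕ (suc (m ℕ+ 1))
    L = aColumn refl a Q b
    T = pColumnTerms e₀ P 𝟙 (zeros R) 𝟙

    pTerms : pColumnTerms e P a Q b ≈ T * L
    pTerms = ≈-trans
      (laplace-congʳ (P zero) (λ j → wide (IH (cong pred e) (minorRC P j) a Q b) refl))
      (laplace-*ʳ (P zero) (λ j → onesRow (sym (ℕ.+-identityʳ (m ℕ+ 1))) (minorRC P j)) L)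

    bTerms : ∀ {q} (e : suc m ℕ+ suc q ≡ suc (m ℕ+ 1) ℕ+ q) a (Q : Mat C (suc q) q) b →
             bColumnTerms e P a Q b ≈ 0#
    bTerms {zero}  e a Q b = ≈-refl
    bTerms {suc q} e a Q b = laplace-vanish b _ (λ k → ≈-trans (*-congˡ
      (otherwise (IH (cong pred (trans e (ℕ.+-suc (suc (m ℕ+ 1)) q))) (dropRow P) a (dropCol Q k) (dropAt b k))
        (ℕ.m≢1+m+n m)
        (λ h → ℕ.m≢1+m+n m (trans h (cong suc (ℕ.+-assoc m 1 1))))
        ℕ.1+n≢n))
      (zeroʳ _))

  -- The P-column minors are again in the remaining
  -- cases.  So are the b-column minors unless p₁ = p₂ + 2; then they are tall,
  -- and their sum Σₖ ±bₖ [bₖ;Qₖ] expands a join with two equal rows.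
  otherwise-step : ∀ m → Hypothesis m → ∀ {p₂ q₁ q₂} (e : suc m ℕ+ q₁ ≡ p₂ ℕ+ q₂) (P : Mat C (suc m) p₂)
                   (a : Vect C q₁) (Q : Mat C q₁ q₂) (b : Vect C q₂) →
                   suc m ≢ p₂ → suc m ≢ p₂ ℕ+ 1 → p₂ ≢ suc m ℕ+ 1 → joinDet e P a Q b ≈ 0#
  otherwise-step m IH {p₂} {q₁} e P a Q b n₁ n₂ n₃ = begin
    joinDet e P a Q b                                           ≈⟨ joinDet-expand e P a Q b ⟩
    pColumnTerms e P a Q b + signℕ p₂ * bColumnTerms e P a Q b  ≈⟨ +-cong (pTerms e P n₁ n₂ n₃) (*-congˡ (bTerms e Q b)) ⟩
    0# + signℕ p₂ * 0#                                          ≈⟨ ≈-trans (+-identityˡ _) (zeroʳ _) ⟩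
    0#                                                          ∎
    where
    pTerms : ∀ {p₂} (e : suc m ℕ+ q₁ ≡ p₂ ℕ+ _) (P : Mat C (suc m) p₂) →
             suc m ≢ p₂ → suc m ≢ p₂ ℕ+ 1 → p₂ ≢ suc m ℕ+ 1 → pColumnTerms e P a Q b ≈ 0#
    pTerms {zero}  e P n₁ n₂ n₃ = ≈-refl
    pTerms {suc p} e P n₁ n₂ n₃ = laplace-vanish (P zero) _ (λ j → ≈-trans (*-congˡ
      (otherwise (IH (cong pred e) (minorRC P j) a Q b) (n₁ ∘ cong suc) (n₂ ∘ cong suc) (n₃ ∘ cong suc)))
      (zeroʳ _))

    bTerms : ∀ {q₂} (e : suc m ℕ+ q₁ ≡ p₂ ℕ+ q₂) (Q : Mat C q₁ q₂) b → bColumnTerms e P a Q b ≈ 0#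
    bTerms {zero}  e Q b = ≈-refl
    bTerms {suc q} e Q b with m ≟ p₂ ℕ+ 1
    ... | yes h = begin
      laplace b (λ k → joinDet e′ (dropRow P) a (dropCol Q k) (dropAt b k))
        ≈⟨ laplace-congʳ b (λ k → tall (IH e′ (dropRow P) a (dropCol Q k) (dropAt b k)) h) ⟩
      laplace b (λ k → W * bRow (dim₂ e′ h) a (dropCol Q k) (dropAt b k))
        ≈⟨ laplace-*ˡ b (λ k → bRow (dim₂ e′ h) a (dropCol Q k) (dropAt b k)) W ⟩
      W * bColumnTerms {p₂ = 0} (cong suc (dim₂ e′ h)) (zeros R) a Q b
        ≈⟨ *-congˡ (bColumnTerms-zeros {p₂ = 0} (cong suc (dim₂ e′ h)) a Q b) ⟩
      W * 0#
        ≈⟨ zeroʳ W ⟩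
      0# ∎
      where
      e′ : m ℕ+ q₁ ≡ p₂ ℕ+ q
      e′ = cong pred (trans e (ℕ.+-suc p₂ q))
      W = onesColumn (trans (ℕ.+-identityʳ m) h) (dropRow P)
    ... | no m≢p₂+1 = laplace-vanish b _ (λ k → ≈-trans (*-congˡ
      (otherwise (IH (cong pred (trans e (ℕ.+-suc p₂ q))) (dropRow P) a (dropCol Q k) (dropAt b k))
        (λ h → n₂ (trans (cong suc h) (ℕ.+-comm 1 p₂)))
        m≢p₂+1
        (λ h → n₁ (sym (trans h (ℕ.+-comm m 1))))))
      (zeroʳ _))

  joinFormula : ∀ p₁ → Hypothesis p₁
  joinFormula zero = joinFormula-base
  joinFormula (suc m) {p₂} {q₁} {q₂} e P a Q b = record
    { square    = λ h → squareCase h (dim₁ e h) e P Q b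
    ; tall      = λ h → tallCase (sym (ℕ.suc-injective (trans h (ℕ.+-comm p₂ 1)))) (sym (dim₂ e h)) e P Q b
    ; wide      = λ h → wideCase h (dim₃ e h) e P a Q
    ; otherwise = otherwise-step m (joinFormula m) e P a Q b
    }
    where
    squareCase : ∀ {p₂ q₂} (h : suc m ≡ p₂) (d : q₁ ≡ q₂) (e : suc m ℕ+ q₁ ≡ p₂ ℕ+ q₂)
                 (P : Mat C (suc m) p₂) (Q : Mat C q₁ q₂) (b : Vect C q₂) →
                 joinDet e P a Q b ≈ detSq R h P * detSq R d Q
                   + - (bordered (cong (_ℕ+ 1) h) P * cornered (cong (1 ℕ+_) d) a Q b)
    squareCase refl refl e P Q b = square-step m (joinFormula m) e P a Q b

    tallCase : ∀ {p₂ q₂} (h : p₂ ≡ m) (d : q₂ ≡ suc q₁) (e : suc m ℕ+ q₁ ≡ p₂ ℕ+ q₂)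
               (P : Mat C (suc m) p₂) (Q : Mat C q₁ q₂) (b : Vect C q₂) →
               joinDet e P a Q b ≈ onesColumn (trans (trans (ℕ.+-identityʳ (suc m)) (ℕ.+-comm 1 m)) (cong (_ℕ+ 1) (sym h))) P
                                   * bRow (sym d) a Q b
    tallCase refl refl e P Q b = tall-step m (joinFormula m) e P a Q b

    wideCase : ∀ {p₂ q₁} (h : p₂ ≡ suc m ℕ+ 1) (d : q₁ ≡ 1 ℕ+ q₂) (e : suc m ℕ+ q₁ ≡ p₂ ℕ+ q₂)
               (P : Mat C (suc m) p₂) (a : Vect C q₁) (Q : Mat C q₁ q₂) →
               joinDet e P a Q b ≈ onesRow (trans (sym h) (sym (ℕ.+-identityʳ p₂))) P * aColumn d a Q b
    wideCase refl refl e P a Q = wide-step m (joinFormula m) e P a Q b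

  hcat-entry : ∀ {m p q} (M : Mat C m p) (N : Mat C m q) i k → hcat M N i k ≡ [ M i , N i ]′ (splitAt p k)
  hcat-entry {p = p} M N i k with splitAt p k
  ... | inj₁ _ = refl
  ... | inj₂ _ = refl

  vcat-entry : ∀ {p q n} (M : Mat C p n) (N : Mat C q n) i k →
               vcat M N i k ≡ [ (λ i′ → M i′ k) , (λ i′ → N i′ k) ]′ (splitAt p i)
  vcat-entry {p = p} M N i k with splitAt p i
  ... | inj₁ _ = refl
  ... | inj₂ _ = refl

  onesColumn≈hcat : ∀ {p₁ p₂} (e : p₁ ℕ+ 0 ≡ p₂ ℕ+ 1) (h : p₁ ≡ p₂ ℕ+ 1) (P : Mat C p₁ p₂) →
                    onesColumn e P ≈ detSq R h (hcat P (ones R))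
  onesColumn≈hcat {p₁} {p₂} e h P = det-cast r _ _ (λ i j → begin
    J i (cast e j)                                        ≡⟨ join-entry P 𝟙 (zeros R) 𝟙 i (cast e j) ⟩
    joinEntry P 𝟙 (zeros R) 𝟙 (splitAt p₁ i) (splitAt p₂ (cast e j))
      ≡⟨ cong (λ s → joinEntry P 𝟙 (zeros R) 𝟙 s (splitAt p₂ (cast e j))) (splitAt-+0 p₁ i) ⟩
    joinEntry P 𝟙 (zeros R) 𝟙 (inj₁ (cast r i)) (splitAt p₂ (cast e j))
      ≡⟨ topBlock (splitAt p₂ (cast e j)) ⟩
    [ P (cast r i) , ones R (cast r i) ]′ (splitAt p₂ (cast e j))
      ≡⟨ hcat-entry P (ones R) (cast r i) (cast e j) ⟨
    hcat P (ones R) (cast r i) (cast e j)                 ≡⟨ cong (hcat P (ones R) (cast r i)) (cast-trans r h j) ⟨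
    hcat P (ones R) (cast r i) (cast h (cast r j))        ∎)
    where
    J = join R P 𝟙 (zeros R) 𝟙
    r : p₁ ℕ+ 0 ≡ p₁
    r = ℕ.+-identityʳ p₁
    topBlock : ∀ {i} t → joinEntry P 𝟙 (zeros R) 𝟙 (inj₁ i) t ≡ [ P i , ones R i ]′ t
    topBlock (inj₁ _) = refl
    topBlock (inj₂ _) = refl

  onesRow≈vcat : ∀ {p₁ p₂} (e : p₁ ℕ+ 1 ≡ p₂ ℕ+ 0) (h : p₁ ℕ+ 1 ≡ p₂) (P : Mat C p₁ p₂) →
                 onesRow e P ≈ detSq R h (vcat P (ones R))
  onesRow≈vcat {p₁} {p₂} e h P = det-cong (λ i j → begin
    J i (cast e j)                                        ≡⟨ join-entry P 𝟙 (zeros R) 𝟙 i (cast e j) ⟩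
    joinEntry P 𝟙 (zeros R) 𝟙 (splitAt p₁ i) (splitAt p₂ (cast e j))
      ≡⟨ cong (joinEntry P 𝟙 (zeros R) 𝟙 (splitAt p₁ i)) (splitAt-+0 p₂ (cast e j)) ⟩
    joinEntry P 𝟙 (zeros R) 𝟙 (splitAt p₁ i) (inj₁ (cast r (cast e j)))
      ≡⟨ leftBlock (splitAt p₁ i) ⟩
    [ (λ i′ → P i′ (cast r (cast e j))) , (λ i′ → ones R i′ (cast r (cast e j))) ]′ (splitAt p₁ i)
      ≡⟨ vcat-entry P (ones R) i (cast r (cast e j)) ⟨
    vcat P (ones R) i (cast r (cast e j))                 ≡⟨ cong (vcat P (ones R) i) (cast-trans e r j) ⟩
    vcat P (ones R) i (cast h j)                          ∎)
    where
    J = join R P 𝟙 (zeros R) 𝟙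
    r : p₂ ℕ+ 0 ≡ p₂
    r = ℕ.+-identityʳ p₂
    leftBlock : ∀ {k} s → joinEntry P 𝟙 (zeros R) 𝟙 s (inj₁ k) ≡ [ (λ i′ → P i′ k) , (λ i′ → ones R i′ k) ]′ s
    leftBlock (inj₁ _) = refl
    leftBlock (inj₂ _) = refl

  bRow≈vcat : ∀ {q₁ q₂} (e : 1 ℕ+ q₁ ≡ q₂) a (Q : Mat C q₁ q₂) b →
              bRow e a Q b ≈ detSq R e (vcat (rowOf R b) Q)
  bRow≈vcat e a Q b = det-cong (λ i j → sameEntries i (cast e j))
    where
    sameEntries : ∀ i k → join R (zeros R) a Q b i k ≈ vcat (rowOf R b) Q i k
    sameEntries zero    k = ≈-refl
    sameEntries (suc i) k = ≈-refl

  aColumn≈hcat : ∀ {q₁ q₂} (e : q₁ ≡ 1 ℕ+ q₂) a (Q : Mat C q₁ q₂) b →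
                 aColumn e a Q b ≈ detSq R e (hcat (colOf R a) Q)
  aColumn≈hcat e a Q b = det-cong (λ i j → sameEntries i (cast e j))
    where
    sameEntries : ∀ i k → join R (zeros R) a Q b i k ≈ hcat (colOf R a) Q i k
    sameEntries i zero    = ≈-refl
    sameEntries i (suc k) = ≈-refl

lemma2p2 : ∀ {c ℓ} (R : CommutativeRing c ℓ) {p₁ p₂ q₁ q₂ : ℕ}
    (e : p₁ ℕ+ q₁ ≡ p₂ ℕ+ q₂)
    (P : Mat (CommutativeRing.Carrier R) p₁ p₂) (Q : Mat (CommutativeRing.Carrier R) q₁ q₂)
    (a : Vect (CommutativeRing.Carrier R) q₁) (b : Vect (CommutativeRing.Carrier R) q₂) →
    let open CommutativeRing R hiding (sym) in
    ((h : p₁ ≡ p₂) →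
       detSq R e (join R P a Q b)
         ≈ (detSq R h P * detSq R (dim₁ e h) Q)
           + - (detSq R (cong (_ℕ+ 1) h) (block P (ones R) (ones R) (zeros R))
                * detSq R (cong (1 ℕ+_) (dim₁ e h)) (block (zeros R) (rowOf R b) (colOf R a) Q)))
    × ((h : p₁ ≡ p₂ ℕ+ 1) →
       detSq R e (join R P a Q b)
         ≈ detSq R h (hcat P (ones R)) * detSq R (dim₂ e h) (vcat (rowOf R b) Q))
    × ((h : p₂ ≡ p₁ ℕ+ 1) →
       detSq R e (join R P a Q b)
         ≈ detSq R (sym h) (vcat P (ones R)) * detSq R (dim₃ e h) (hcat (colOf R a) Q))
    × (p₁ ≢ p₂ → p₁ ≢ p₂ ℕ+ 1 → p₂ ≢ p₁ ℕ+ 1 →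
       detSq R e (join R P a Q b) ≈ 0#)
lemma2p2 R {p₁} {p₂} e P Q a b =
    square formula
  , (λ h → ≈-trans (tall formula h)
             (*-cong (onesColumn≈hcat (trans (ℕ.+-identityʳ p₁) h) h P) (bRow≈vcat (dim₂ e h) a Q b)))
  , (λ h → ≈-trans (wide formula h)
             (*-cong (onesRow≈vcat (trans (sym h) (sym (ℕ.+-identityʳ p₂))) (sym h) P) (aColumn≈hcat (dim₃ e h) a Q b)))
  , otherwise formula
  where
  open JoinDeterminant R
  open JoinFormula
  open CommutativeRing R using (*-cong) renaming (trans to ≈-trans)
  formula = joinFormula p₁ e P a Q b
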